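{- Let $k\ge 1$ be an integer. For the distance game $\textsc{EnCis}(k)$ played on the path $P_n$ with $n$ vertices, the polynomial profile satisfies \[P_{\textsc{EnCis}(k),P_n}(x,y)=1+nx+ny \quad\text{for } 0\le n\le k,\] and for $n>k$, \[P_{\textsc{EnCis}(k),P_n}(x,y)= P_{\textsc{EnCis}(k),P_{n-1}}(x,y)+(x+y)P_{\textsc{EnCis}(k),P_{n-(k+1)}}(x,y).\] Consequently the total number of positions satisfies $P_{\textsc{EnCis}(k),P_n}(1,1)=2n+1$ for $n\le k$ and \[P_{\textsc{EnCis}(k),P_n}(1,1)=P_{\textsc{EnCis}(k),P_{n-1}}(1,1)+2P_{\textsc{EnCis}(k),P_{n-(k+1)}}(1,1)\quad\text{for } n>k.\]
   Context: A distance game given by a pair of sets $(S,D)$ of positive integers is played on a finite graph by two players, Left (colouring vertices blue) and Right (colouring vertices red). A position is any assignment to a subset of the vertices of the colours blue or red (other vertices empty) such that no two vertices of the same colour are at graph distance in $S$ and no two vertices of different colours are at graph distance in $D$; no assumption of alternating play is made. $\textsc{EnCis}(k)$ is the distance game with $S=D=\{1,\dots,k\}$. The polynomial profile of a game $G$ on a board $B$ is $P_{G,B}(x,y)=\sum f_{j,l}x^jy^l$, where $f_{j,l}$ is the number of positions with exactly $j$ blue and $l$ red vertices. $P_n$ denotes the path with $n$ vertices; $P_0$ is the empty board, whose only position is the empty one (profile $1$). -}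

module Defs where

open import Data.Nat using (ℕ; zero; suc; _+_; _*_; _≤ᵇ_; _≡ᵇ_; ∣_-_∣)
open import Data.Bool using (Bool; true; false; _∧_; _∨_; not; if_then_else_)
open import Data.Fin using (Fin; toℕ)
open import Data.Vec using (Vec; []; _∷_; lookup)
open import Data.List using (List; []; _∷_; map; concatMap; allFin; filterᵇ; length)
open import Data.Maybe using (Maybe; just; nothing)

-- Colours: Left colours blue, Right colours red.
data Colour : Set where
  blue red : Colour

sameColour : Colour → Colour → Bool
sameColour blue blue = true
sameColour red  red  = true
sameColour _    _    = false

Assignment : ℕ → Set
Assignment n = Vec (Maybe Colour) n

allAssignments : (n : ℕ) → List (Assignment n)
allAssignments zero    = [] ∷ []
allAssignments (suc n) =
  concatMap (λ v → (nothing ∷ v) ∷ (just blue ∷ v) ∷ (just red ∷ v) ∷ []) (allAssignments n)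

pathDist : {n : ℕ} → Fin n → Fin n → ℕ
pathDist i j = ∣ toℕ i - toℕ j ∣

pairOK : (S D : ℕ → Bool) → ℕ → Maybe Colour → Maybe Colour → Bool
pairOK S D d (just a) (just b) =
  if sameColour a b then not (S d) else not (D d)
pairOK S D d _ _ = true

allᵇ : {A : Set} → (A → Bool) → List A → Bool
allᵇ p [] = true
allᵇ p (x ∷ xs) = p x ∧ allᵇ p xs

isPosition : (S D : ℕ → Bool) → {n : ℕ} → Assignment n → Bool
isPosition S D {n} v =
  allᵇ (λ i → allᵇ (λ j →
         (toℕ i ≡ᵇ toℕ j) ∨ pairOK S D (pathDist i j) (lookup v i) (lookup v j))
       (allFin n)) (allFin n)

upTo : ℕ → ℕ → Bool
upTo k d = (1 ≤ᵇ d) ∧ (d ≤ᵇ k)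

positions : (k n : ℕ) → List (Assignment n)
positions k n = filterᵇ (isPosition (upTo k) (upTo k)) (allAssignments n)

isBlue isRed : Maybe Colour → Bool
isBlue (just blue) = true
isBlue _           = false
isRed (just red) = true
isRed _          = false

countV : {n : ℕ} → (Maybe Colour → Bool) → Assignment n → ℕ
countV p []       = 0
countV p (c ∷ v)  = (if p c then 1 else 0) + countV p v

-- Bivariate polynomials with ℕ coefficients, as coefficient functions:
-- P j l = coefficient of x^j y^l.
Poly : Set
Poly = ℕ → ℕ → ℕ

profile : (k n : ℕ) → Poly
profile k n j l =
  length (filterᵇ (λ v → (countV isBlue v ≡ᵇ j) ∧ (countV isRed v ≡ᵇ l)) (positions k n))

_⊕_ : Poly → Poly → Poly
(P ⊕ Q) j l = P j l + Q j l

xTimes yTimes : Poly → Poly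
xTimes P zero    l = 0
xTimes P (suc j) l = P j l
yTimes P j zero    = 0
yTimes P j (suc l) = P j l

xyTimes : Poly → Poly
xyTimes P = xTimes P ⊕ yTimes P

onePlusNxNy : ℕ → Poly
onePlusNxNy n zero          zero          = 1
onePlusNxNy n (suc zero)    zero          = n
onePlusNxNy n zero          (suc zero)    = n
onePlusNxNy n _             _             = 0

-- P_{EnCis(k),P_n}(1,1) = sum of all coefficients = total number of positions.
total : (k n : ℕ) → ℕ
total k n = length (positions k n)

-- For EnCis(k) we have S = D, so the colours of two vertices never affect whether they may coexist:
-- a position on a path is exactly an assignment in which any two coloured vertices are more than
-- k apart. Classify positions on P_n by their first vertex. If it is empty, the rest is a position
-- on P_(n-1). If it is coloured (contributing x or y), the next k vertices must be empty and what
-- follows is an arbitrary position on P_(n-k-1); when n ≤ k this forces everything else empty,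
-- which adds exactly the monomials x and y.
module Submission where

open import Defs
open import Algebra.Bundles using (CommutativeMonoid)
open import Data.Bool using (Bool; true; false; _∧_; _∨_; not; if_then_else_)
open import Data.Bool.Properties using (∧-assoc; ∧-idem; ∧-zeroʳ; ∧-commutativeMonoid)
open import Algebra.Properties.CommutativeSemigroup
  (CommutativeMonoid.commutativeSemigroup ∧-commutativeMonoid)
  using () renaming (interchange to ∧-interchange)
open import Data.Nat using (ℕ; zero; suc; _+_; _*_; _∸_; _≤_; _<_; s≤s; _<ᵇ_; _≡ᵇ_)
open import Data.Nat.Properties
  using (+-identityʳ; +-assoc; +-comm; +-commutativeSemigroup; m+[n∸m]≡n; <⇒≤)
open import Algebra.Properties.CommutativeSemigroup +-commutativeSemigroup
  using () renaming (interchange to +-interchange)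
open import Data.Nat.Tactic.RingSolver using (solve-∀)
open import Data.Product using (_×_; _,_)
open import Data.Fin using (Fin; toℕ) renaming (zero to fzero; suc to fsuc)
open import Data.Vec using ([]; _∷_; lookup; _++_)
open import Data.List using (List; []; _∷_; concatMap; filterᵇ; length; tabulate)
  renaming (_++_ to _++ˡ_)
open import Data.Maybe using (Maybe; just; nothing; is-just)
open import Relation.Binary.PropositionalEquality
  using (_≡_; refl; sym; trans; cong; cong₂; subst; module ≡-Reasoning)

open ≡-Reasoning

when : Bool → ℕ → ℕ
when b n = if b then n else 0

when-∧ : ∀ a b n → when (a ∧ b) n ≡ when a (when b n)
when-∧ true  b n = refl
when-∧ false b n = refl

when-zero : ∀ b → when b 0 ≡ 0
when-zero true  = refl
when-zero false = refl

sumBy : {A : Set} → (A → ℕ) → List A → ℕ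
sumBy f []       = 0
sumBy f (x ∷ xs) = f x + sumBy f xs

module _ {A : Set} where

  sumBy-cong : {f g : A → ℕ} → (∀ x → f x ≡ g x) → ∀ xs → sumBy f xs ≡ sumBy g xs
  sumBy-cong f≗g []       = refl
  sumBy-cong f≗g (x ∷ xs) = cong₂ _+_ (f≗g x) (sumBy-cong f≗g xs)

  sumBy-zero : ∀ xs → sumBy (λ (_ : A) → 0) xs ≡ 0
  sumBy-zero []       = refl
  sumBy-zero (x ∷ xs) = sumBy-zero xs

  sumBy-+ : ∀ (f g : A → ℕ) xs → sumBy (λ x → f x + g x) xs ≡ sumBy f xs + sumBy g xs
  sumBy-+ f g []       = refl
  sumBy-+ f g (x ∷ xs) =
    trans (cong (f x + g x +_) (sumBy-+ f g xs)) (+-interchange (f x) (g x) _ _)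

  sumBy-++ : ∀ (f : A → ℕ) xs ys → sumBy f (xs ++ˡ ys) ≡ sumBy f xs + sumBy f ys
  sumBy-++ f []       ys = refl
  sumBy-++ f (x ∷ xs) ys = trans (cong (f x +_) (sumBy-++ f xs ys)) (sym (+-assoc (f x) _ _))

  sumBy-filterᵇ : ∀ (f : A → ℕ) p xs →
    sumBy f (filterᵇ p xs) ≡ sumBy (λ x → when (p x) (f x)) xs
  sumBy-filterᵇ f p []       = refl
  sumBy-filterᵇ f p (x ∷ xs) with p x
  ... | true  = cong (f x +_) (sumBy-filterᵇ f p xs)
  ... | false = sumBy-filterᵇ f p xs

  length≡sumBy-1 : ∀ (xs : List A) → length xs ≡ sumBy (λ _ → 1) xs
  length≡sumBy-1 []       = refl
  length≡sumBy-1 (x ∷ xs) = cong suc (length≡sumBy-1 xs)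

sumBy-concatMap : {A B : Set} (f : B → ℕ) (g : A → List B) (xs : List A) →
  sumBy f (concatMap g xs) ≡ sumBy (λ x → sumBy f (g x)) xs
sumBy-concatMap f g []       = refl
sumBy-concatMap f g (x ∷ xs) =
  trans (sumBy-++ f (g x) (concatMap g xs)) (cong (sumBy f (g x) +_) (sumBy-concatMap f g xs))

sumAssignments : (n : ℕ) → (Assignment n → ℕ) → ℕ
sumAssignments n F = sumBy F (allAssignments n)

sumAssignments-suc : ∀ n (F : Assignment (suc n) → ℕ) →
  sumAssignments (suc n) F ≡
  sumAssignments n (λ w → F (nothing ∷ w))
    + (sumAssignments n (λ w → F (just blue ∷ w)) + sumAssignments n (λ w → F (just red ∷ w)))
sumAssignments-suc n F = begin
    sumBy F (allAssignments (suc n))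
  ≡⟨ sumBy-concatMap F (λ w → (nothing ∷ w) ∷ (just blue ∷ w) ∷ (just red ∷ w) ∷ [])
                       (allAssignments n) ⟩
    sumBy (λ w → F (nothing ∷ w) + (F (just blue ∷ w) + (F (just red ∷ w) + 0))) (allAssignments n)
  ≡⟨ sumBy-cong (λ w → cong (λ r → F (nothing ∷ w) + (F (just blue ∷ w) + r)) (+-identityʳ _))
                (allAssignments n) ⟩
    sumBy (λ w → F (nothing ∷ w) + (F (just blue ∷ w) + F (just red ∷ w))) (allAssignments n)
  ≡⟨ sumBy-+ _ _ (allAssignments n) ⟩
    sumAssignments n (λ w → F (nothing ∷ w))
      + sumBy (λ w → F (just blue ∷ w) + F (just red ∷ w)) (allAssignments n)
  ≡⟨ cong (sumAssignments n (λ w → F (nothing ∷ w)) +_) (sumBy-+ _ _ (allAssignments n)) ⟩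
    sumAssignments n (λ w → F (nothing ∷ w))
      + (sumAssignments n (λ w → F (just blue ∷ w)) + sumAssignments n (λ w → F (just red ∷ w)))
  ∎

nothings : (n : ℕ) → Assignment n
nothings zero    = []
nothings (suc n) = nothing ∷ nothings n

emptyPrefix : {n : ℕ} → ℕ → Assignment n → Bool
emptyPrefix zero    w             = true
emptyPrefix (suc k) []            = true
emptyPrefix (suc k) (nothing ∷ w) = emptyPrefix k w
emptyPrefix (suc k) (just _ ∷ w)  = false

sumAssignments-emptyPrefix-suc : ∀ k n (F : Assignment (suc n) → ℕ) →
  sumAssignments (suc n) (λ w → when (emptyPrefix (suc k) w) (F w)) ≡
  sumAssignments n (λ w → when (emptyPrefix k w) (F (nothing ∷ w)))
sumAssignments-emptyPrefix-suc k n F =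
  trans (sumAssignments-suc n _) (trans (cong (rest +_) (cong₂ _+_ vanish vanish)) (+-identityʳ rest))
  where
  rest : ℕ
  rest = sumAssignments n (λ w → when (emptyPrefix k w) (F (nothing ∷ w)))
  vanish : sumAssignments n (λ _ → 0) ≡ 0
  vanish = sumBy-zero (allAssignments n)

sumAssignments-emptyPrefix-≤ : ∀ {k n} → n ≤ k → (F : Assignment n → ℕ) →
  sumAssignments n (λ w → when (emptyPrefix k w) (F w)) ≡ F (nothings n)
sumAssignments-emptyPrefix-≤ {zero}  {zero}  _         F = +-identityʳ _
sumAssignments-emptyPrefix-≤ {suc k} {zero}  _         F = +-identityʳ _
sumAssignments-emptyPrefix-≤ {suc k} {suc n} (s≤s n≤k) F =
  trans (sumAssignments-emptyPrefix-suc k n F)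
        (sumAssignments-emptyPrefix-≤ n≤k (λ w → F (nothing ∷ w)))

sumAssignments-emptyPrefix-+ : ∀ k m (F : Assignment (k + m) → ℕ) →
  sumAssignments (k + m) (λ w → when (emptyPrefix k w) (F w)) ≡
  sumAssignments m (λ w → F (nothings k ++ w))
sumAssignments-emptyPrefix-+ zero    m F = refl
sumAssignments-emptyPrefix-+ (suc k) m F =
  trans (sumAssignments-emptyPrefix-suc k (k + m) F)
        (sumAssignments-emptyPrefix-+ k m (λ w → F (nothing ∷ w)))

allFinᵇ : (n : ℕ) → (Fin n → Bool) → Bool
allFinᵇ zero    g = true
allFinᵇ (suc n) g = g fzero ∧ allFinᵇ n (λ i → g (fsuc i))

allFinᵇ-cong : ∀ n {g h : Fin n → Bool} → (∀ i → g i ≡ h i) → allFinᵇ n g ≡ allFinᵇ n h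
allFinᵇ-cong zero    g≗h = refl
allFinᵇ-cong (suc n) g≗h = cong₂ _∧_ (g≗h fzero) (allFinᵇ-cong n (λ i → g≗h (fsuc i)))

allFinᵇ-true : ∀ n (g : Fin n → Bool) → (∀ i → g i ≡ true) → allFinᵇ n g ≡ true
allFinᵇ-true n g g≗true = trans (allFinᵇ-cong n g≗true) (allFinᵇ-const n)
  where
  allFinᵇ-const : ∀ n → allFinᵇ n (λ _ → true) ≡ true
  allFinᵇ-const zero    = refl
  allFinᵇ-const (suc n) = allFinᵇ-const n

allFinᵇ-∧ : ∀ n (g h : Fin n → Bool) →
  allFinᵇ n (λ i → g i ∧ h i) ≡ allFinᵇ n g ∧ allFinᵇ n h
allFinᵇ-∧ zero    g h = refl
allFinᵇ-∧ (suc n) g h =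
  trans (cong ((g fzero ∧ h fzero) ∧_) (allFinᵇ-∧ n (λ i → g (fsuc i)) (λ i → h (fsuc i))))
        (∧-interchange (g fzero) (h fzero) _ _)

allᵇ-tabulate : {A : Set} (n : ℕ) (p : A → Bool) (f : Fin n → A) →
  allᵇ p (tabulate f) ≡ allFinᵇ n (λ i → p (f i))
allᵇ-tabulate zero    p f = refl
allᵇ-tabulate (suc n) p f = cong (p (f fzero) ∧_) (allᵇ-tabulate n p (λ i → f (fsuc i)))

pairOK-comm : ∀ S D d (a b : Maybe Colour) → pairOK S D d a b ≡ pairOK S D d b a
pairOK-comm S D d nothing     nothing     = refl
pairOK-comm S D d nothing     (just _)    = refl
pairOK-comm S D d (just _)    nothing     = refl
pairOK-comm S D d (just blue) (just blue) = refl
pairOK-comm S D d (just blue) (just red)  = refl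
pairOK-comm S D d (just red)  (just blue) = refl
pairOK-comm S D d (just red)  (just red)  = refl

pairOK-colourBlind : ∀ S d (a b : Maybe Colour) →
  pairOK S S d a b ≡ not (is-just a ∧ is-just b ∧ S d)
pairOK-colourBlind S d nothing     b           = refl
pairOK-colourBlind S d (just _)    nothing     = refl
pairOK-colourBlind S d (just blue) (just blue) = refl
pairOK-colourBlind S d (just blue) (just red)  = refl
pairOK-colourBlind S d (just red)  (just blue) = refl
pairOK-colourBlind S d (just red)  (just red)  = refl

noneOccupiedBelow≡emptyPrefix : ∀ k {n} (w : Assignment n) →
  allFinᵇ n (λ j → not (is-just (lookup w j) ∧ (toℕ j <ᵇ k))) ≡ emptyPrefix k w
noneOccupiedBelow≡emptyPrefix zero    w =
  allFinᵇ-true _ _ (λ j → cong not (∧-zeroʳ (is-just (lookup w j))))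
noneOccupiedBelow≡emptyPrefix (suc k) []            = refl
noneOccupiedBelow≡emptyPrefix (suc k) (nothing ∷ w) = noneOccupiedBelow≡emptyPrefix k w
noneOccupiedBelow≡emptyPrefix (suc k) (just _ ∷ w)  = refl

clearAfter : (k : ℕ) {n : ℕ} → Maybe Colour → Assignment n → Bool
clearAfter k nothing  w = true
clearAfter k (just _) w = emptyPrefix k w

isSpaced : (k : ℕ) {n : ℕ} → Assignment n → Bool
isSpaced k []      = true
isSpaced k (c ∷ w) = clearAfter k c w ∧ isSpaced k w

-- upTo k (suc d) computes to d <ᵇ k, so no arithmetic on the distance is needed.
pairOK-after≡clearAfter : ∀ k {n} c (w : Assignment n) →
  allFinᵇ n (λ j → pairOK (upTo k) (upTo k) (suc (toℕ j)) c (lookup w j)) ≡ clearAfter k c w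
pairOK-after≡clearAfter k {n} c w =
  trans (allFinᵇ-cong n (λ j → pairOK-colourBlind (upTo k) (suc (toℕ j)) c (lookup w j)))
        (byHead c)
  where
  byHead : ∀ c → allFinᵇ n (λ j → not (is-just c ∧ is-just (lookup w j) ∧ (toℕ j <ᵇ k)))
                 ≡ clearAfter k c w
  byHead nothing  = allFinᵇ-true n _ (λ _ → refl)
  byHead (just _) = noneOccupiedBelow≡emptyPrefix k w

compatible : (k : ℕ) {n : ℕ} → Assignment n → Fin n → Fin n → Bool
compatible k v i j =
  (toℕ i ≡ᵇ toℕ j) ∨ pairOK (upTo k) (upTo k) (pathDist i j) (lookup v i) (lookup v j)

allCompatible : (k : ℕ) {n : ℕ} → Assignment n → Bool
allCompatible k {n} v = allFinᵇ n (λ i → allFinᵇ n (compatible k v i))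

isPosition≡allCompatible : ∀ k {n} (v : Assignment n) →
  isPosition (upTo k) (upTo k) v ≡ allCompatible k v
isPosition≡allCompatible k {n} v =
  trans (allᵇ-tabulate n _ (λ i → i)) (allFinᵇ-cong n (λ i → allᵇ-tabulate n _ (λ j → j)))

-- The head's row and column of the compatibility matrix both say clearAfter k c w;
-- the remaining block is the matrix of w, since path distances are translation invariant.
allCompatible-∷ : ∀ k {n} c (w : Assignment n) →
  allCompatible k (c ∷ w) ≡ clearAfter k c w ∧ allCompatible k w
allCompatible-∷ k {n} c w = begin
    allCompatible k (c ∷ w)
  ≡⟨ cong₂ _∧_ (pairOK-after≡clearAfter k c w) (allFinᵇ-∧ n _ _) ⟩
    H ∧ (allFinᵇ n (λ i → pairOK S S (suc (toℕ i)) (lookup w i) c) ∧ allCompatible k w)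
  ≡⟨ cong (λ b → H ∧ (b ∧ allCompatible k w)) before≡clearAfter ⟩
    H ∧ (H ∧ allCompatible k w)
  ≡⟨ sym (∧-assoc H H _) ⟩
    (H ∧ H) ∧ allCompatible k w
  ≡⟨ cong (_∧ allCompatible k w) (∧-idem H) ⟩
    H ∧ allCompatible k w
  ∎
  where
  S : ℕ → Bool
  S = upTo k
  H : Bool
  H = clearAfter k c w
  before≡clearAfter : allFinᵇ n (λ i → pairOK S S (suc (toℕ i)) (lookup w i) c) ≡ H
  before≡clearAfter =
    trans (allFinᵇ-cong n (λ i → pairOK-comm S S _ (lookup w i) c))
          (pairOK-after≡clearAfter k c w)

isPosition≡isSpaced : ∀ k {n} (v : Assignment n) → isPosition (upTo k) (upTo k) v ≡ isSpaced k v
isPosition≡isSpaced k v = trans (isPosition≡allCompatible k v) (allCompatible≡isSpaced v)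
  where
  allCompatible≡isSpaced : ∀ {n} (v : Assignment n) → allCompatible k v ≡ isSpaced k v
  allCompatible≡isSpaced []      = refl
  allCompatible≡isSpaced (c ∷ w) =
    trans (allCompatible-∷ k c w) (cong (clearAfter k c w ∧_) (allCompatible≡isSpaced w))

isSpaced-nothings : ∀ k n → isSpaced k (nothings n) ≡ true
isSpaced-nothings k zero    = refl
isSpaced-nothings k (suc n) = isSpaced-nothings k n

isSpaced-nothings-++ : ∀ k n {m} (w : Assignment m) → isSpaced k (nothings n ++ w) ≡ isSpaced k w
isSpaced-nothings-++ k zero    w = refl
isSpaced-nothings-++ k (suc n) w = isSpaced-nothings-++ k n w

sumPositions : (k n : ℕ) → (Assignment n → ℕ) → ℕ
sumPositions k n F = sumAssignments n (λ v → when (isSpaced k v) (F v))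

sumPositions-cong : ∀ k n {F G : Assignment n → ℕ} → (∀ v → F v ≡ G v) →
  sumPositions k n F ≡ sumPositions k n G
sumPositions-cong k n F≗G =
  sumBy-cong (λ v → cong (when (isSpaced k v)) (F≗G v)) (allAssignments n)

sumPositions-zero : ∀ k n → sumPositions k n (λ _ → 0) ≡ 0
sumPositions-zero k n =
  trans (sumBy-cong (λ v → when-zero (isSpaced k v)) (allAssignments n))
        (sumBy-zero (allAssignments n))

sumBy-positions : ∀ k n (F : Assignment n → ℕ) → sumBy F (positions k n) ≡ sumPositions k n F
sumBy-positions k n F =
  trans (sumBy-filterᵇ F _ (allAssignments n))
        (sumBy-cong (λ v → cong (λ b → when b (F v)) (isPosition≡isSpaced k v))
                    (allAssignments n))

sumPositions-suc : ∀ k n (F : Assignment (suc n) → ℕ) →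
  sumPositions k (suc n) F ≡
  sumPositions k n (λ w → F (nothing ∷ w))
    + (sumAssignments n (λ w → when (emptyPrefix k w) (when (isSpaced k w) (F (just blue ∷ w))))
       + sumAssignments n (λ w → when (emptyPrefix k w) (when (isSpaced k w) (F (just red ∷ w)))))
sumPositions-suc k n F =
  trans (sumAssignments-suc n _)
        (cong (sumPositions k n (λ w → F (nothing ∷ w)) +_)
              (cong₂ _+_ (afterColour blue) (afterColour red)))
  where
  afterColour : ∀ a →
    sumAssignments n (λ w → when (emptyPrefix k w ∧ isSpaced k w) (F (just a ∷ w))) ≡
    sumAssignments n (λ w → when (emptyPrefix k w) (when (isSpaced k w) (F (just a ∷ w))))
  afterColour a = sumBy-cong (λ w → when-∧ (emptyPrefix k w) (isSpaced k w) _) (allAssignments n)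

sumPositions-suc-≤ : ∀ {k n} → n ≤ k → (F : Assignment (suc n) → ℕ) →
  sumPositions k (suc n) F ≡
  sumPositions k n (λ w → F (nothing ∷ w)) + (F (just blue ∷ nothings n) + F (just red ∷ nothings n))
sumPositions-suc-≤ {k} {n} n≤k F =
  trans (sumPositions-suc k n F)
        (cong (sumPositions k n (λ w → F (nothing ∷ w)) +_)
              (cong₂ _+_ (afterColour blue) (afterColour red)))
  where
  afterColour : ∀ a →
    sumAssignments n (λ w → when (emptyPrefix k w) (when (isSpaced k w) (F (just a ∷ w)))) ≡
    F (just a ∷ nothings n)
  afterColour a =
    trans (sumAssignments-emptyPrefix-≤ n≤k _)
          (cong (λ b → when b (F (just a ∷ nothings n))) (isSpaced-nothings k n))

sumPositions-suc-+ : ∀ k m (F : Assignment (suc (k + m)) → ℕ) →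
  sumPositions k (suc (k + m)) F ≡
  sumPositions k (k + m) (λ w → F (nothing ∷ w))
    + (sumPositions k m (λ w → F (just blue ∷ nothings k ++ w))
       + sumPositions k m (λ w → F (just red ∷ nothings k ++ w)))
sumPositions-suc-+ k m F =
  trans (sumPositions-suc k (k + m) F)
        (cong (sumPositions k (k + m) (λ w → F (nothing ∷ w)) +_)
              (cong₂ _+_ (afterColour blue) (afterColour red)))
  where
  afterColour : ∀ a →
    sumAssignments (k + m) (λ w → when (emptyPrefix k w) (when (isSpaced k w) (F (just a ∷ w)))) ≡
    sumPositions k m (λ w → F (just a ∷ nothings k ++ w))
  afterColour a =
    trans (sumAssignments-emptyPrefix-+ k m _)
          (sumBy-cong (λ w → cong (λ b → when b (F (just a ∷ nothings k ++ w)))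
                                  (isSpaced-nothings-++ k k w))
                      (allAssignments m))

infix 4 _≐_

_≐_ : Poly → Poly → Set
P ≐ Q = ∀ j l → P j l ≡ Q j l

xTimes-cong : ∀ {P Q} → P ≐ Q → xTimes P ≐ xTimes Q
xTimes-cong P≐Q zero    l = refl
xTimes-cong P≐Q (suc j) l = P≐Q j l

yTimes-cong : ∀ {P Q} → P ≐ Q → yTimes P ≐ yTimes Q
yTimes-cong P≐Q j zero    = refl
yTimes-cong P≐Q j (suc l) = P≐Q j l

monomial : {n : ℕ} → Assignment n → Poly
monomial v j l = when ((countV isBlue v ≡ᵇ j) ∧ (countV isRed v ≡ᵇ l)) 1

monomial-blue : ∀ {n} (v : Assignment n) → monomial (just blue ∷ v) ≐ xTimes (monomial v)
monomial-blue v zero    l = refl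
monomial-blue v (suc j) l = refl

monomial-red : ∀ {n} (v : Assignment n) → monomial (just red ∷ v) ≐ yTimes (monomial v)
monomial-red v j zero    = cong (λ b → when b 1) (∧-zeroʳ (countV isBlue v ≡ᵇ j))
monomial-red v j (suc l) = refl

monomial-nothings : ∀ n → monomial (nothings n) ≐ onePlusNxNy 0
monomial-nothings zero zero          zero          = refl
monomial-nothings zero zero          (suc zero)    = refl
monomial-nothings zero zero          (suc (suc l)) = refl
monomial-nothings zero (suc zero)    zero          = refl
monomial-nothings zero (suc zero)    (suc l)       = refl
monomial-nothings zero (suc (suc j)) l             = refl
monomial-nothings (suc n)                          = monomial-nothings n

monomial-nothings-++ : ∀ n {m} (w : Assignment m) → monomial (nothings n ++ w) ≐ monomial w
monomial-nothings-++ zero    w j l = refl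
monomial-nothings-++ (suc n) w     = monomial-nothings-++ n w

sumPositions-xTimes : ∀ k m (G : Assignment m → Poly) →
  (λ j l → sumPositions k m (λ w → xTimes (G w) j l))
    ≐ xTimes (λ j l → sumPositions k m (λ w → G w j l))
sumPositions-xTimes k m G zero    l = sumPositions-zero k m
sumPositions-xTimes k m G (suc j) l = refl

sumPositions-yTimes : ∀ k m (G : Assignment m → Poly) →
  (λ j l → sumPositions k m (λ w → yTimes (G w) j l))
    ≐ yTimes (λ j l → sumPositions k m (λ w → G w j l))
sumPositions-yTimes k m G j zero    = sumPositions-zero k m
sumPositions-yTimes k m G j (suc l) = refl

profile≡sumPositions : ∀ k n → profile k n ≐ (λ j l → sumPositions k n (λ v → monomial v j l))
profile≡sumPositions k n j l =
  trans (length≡sumBy-1 (filterᵇ _ (positions k n)))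
        (trans (sumBy-filterᵇ (λ _ → 1) _ (positions k n))
               (sumBy-positions k n (λ v → monomial v j l)))

total≡sumPositions : ∀ k n → total k n ≡ sumPositions k n (λ _ → 1)
total≡sumPositions k n = trans (length≡sumBy-1 (positions k n)) (sumBy-positions k n (λ _ → 1))

onePlusNxNy-suc : ∀ n → onePlusNxNy (suc n) ≐ onePlusNxNy n ⊕ xyTimes (onePlusNxNy 0)
onePlusNxNy-suc n zero                zero                = refl
onePlusNxNy-suc n zero                (suc zero)          = +-comm 1 n
onePlusNxNy-suc n zero                (suc (suc zero))    = refl
onePlusNxNy-suc n zero                (suc (suc (suc l))) = refl
onePlusNxNy-suc n (suc zero)          zero                = +-comm 1 n
onePlusNxNy-suc n (suc zero)          (suc zero)          = refl
onePlusNxNy-suc n (suc zero)          (suc (suc zero))    = refl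
onePlusNxNy-suc n (suc zero)          (suc (suc (suc l))) = refl
onePlusNxNy-suc n (suc (suc zero))    zero                = refl
onePlusNxNy-suc n (suc (suc zero))    (suc zero)          = refl
onePlusNxNy-suc n (suc (suc zero))    (suc (suc zero))    = refl
onePlusNxNy-suc n (suc (suc zero))    (suc (suc (suc l))) = refl
onePlusNxNy-suc n (suc (suc (suc j))) zero                = refl
onePlusNxNy-suc n (suc (suc (suc j))) (suc zero)          = refl
onePlusNxNy-suc n (suc (suc (suc j))) (suc (suc zero))    = refl
onePlusNxNy-suc n (suc (suc (suc j))) (suc (suc (suc l))) = refl

profile-≤ : ∀ {k n} → n ≤ k → profile k n ≐ onePlusNxNy n
profile-≤ {k} {zero}  _   j l =
  trans (profile≡sumPositions k 0 j l) (trans (+-identityʳ _) (monomial-nothings 0 j l))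
profile-≤ {k} {suc n} n<k j l = begin
    profile k (suc n) j l
  ≡⟨ profile≡sumPositions k (suc n) j l ⟩
    sumPositions k (suc n) (λ v → monomial v j l)
  ≡⟨ sumPositions-suc-≤ (<⇒≤ n<k) _ ⟩
    sumPositions k n (λ w → monomial w j l)
      + (monomial (just blue ∷ nothings n) j l + monomial (just red ∷ nothings n) j l)
  ≡⟨ cong₂ _+_ (trans (sym (profile≡sumPositions k n j l)) (profile-≤ (<⇒≤ n<k) j l))
               (cong₂ _+_ (trans (monomial-blue (nothings n) j l)
                                 (xTimes-cong (monomial-nothings n) j l))
                          (trans (monomial-red (nothings n) j l)
                                 (yTimes-cong (monomial-nothings n) j l))) ⟩
    (onePlusNxNy n ⊕ xyTimes (onePlusNxNy 0)) j l
  ≡⟨ sym (onePlusNxNy-suc n j l) ⟩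
    onePlusNxNy (suc n) j l
  ∎

profile-suc-+ : ∀ k m → profile k (suc (k + m)) ≐ profile k (k + m) ⊕ xyTimes (profile k m)
profile-suc-+ k m j l = begin
    profile k (suc (k + m)) j l
  ≡⟨ profile≡sumPositions k (suc (k + m)) j l ⟩
    sumPositions k (suc (k + m)) (λ v → monomial v j l)
  ≡⟨ sumPositions-suc-+ k m _ ⟩
    sumPositions k (k + m) (λ w → monomial w j l)
      + (sumPositions k m (λ w → monomial (just blue ∷ nothings k ++ w) j l)
         + sumPositions k m (λ w → monomial (just red ∷ nothings k ++ w) j l))
  ≡⟨ cong₂ _+_ (sym (profile≡sumPositions k (k + m) j l)) (cong₂ _+_ afterBlue afterRed) ⟩
    (profile k (k + m) ⊕ xyTimes (profile k m)) j l
  ∎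
  where
  afterBlue : sumPositions k m (λ w → monomial (just blue ∷ nothings k ++ w) j l)
              ≡ xTimes (profile k m) j l
  afterBlue = begin
      sumPositions k m (λ w → monomial (just blue ∷ nothings k ++ w) j l)
    ≡⟨ sumPositions-cong k m (λ w → trans (monomial-blue (nothings k ++ w) j l)
                                          (xTimes-cong (monomial-nothings-++ k w) j l)) ⟩
      sumPositions k m (λ w → xTimes (monomial w) j l)
    ≡⟨ sumPositions-xTimes k m monomial j l ⟩
      xTimes (λ j l → sumPositions k m (λ w → monomial w j l)) j l
    ≡⟨ xTimes-cong (λ j l → sym (profile≡sumPositions k m j l)) j l ⟩
      xTimes (profile k m) j l
    ∎
  afterRed : sumPositions k m (λ w → monomial (just red ∷ nothings k ++ w) j l)
             ≡ yTimes (profile k m) j l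
  afterRed = begin
      sumPositions k m (λ w → monomial (just red ∷ nothings k ++ w) j l)
    ≡⟨ sumPositions-cong k m (λ w → trans (monomial-red (nothings k ++ w) j l)
                                          (yTimes-cong (monomial-nothings-++ k w) j l)) ⟩
      sumPositions k m (λ w → yTimes (monomial w) j l)
    ≡⟨ sumPositions-yTimes k m monomial j l ⟩
      yTimes (λ j l → sumPositions k m (λ w → monomial w j l)) j l
    ≡⟨ yTimes-cong (λ j l → sym (profile≡sumPositions k m j l)) j l ⟩
      yTimes (profile k m) j l
    ∎

total-≤ : ∀ {k n} → n ≤ k → total k n ≡ 2 * n + 1
total-≤ {k} {zero}  _   = refl
total-≤ {k} {suc n} n<k = begin
    total k (suc n)
  ≡⟨ total≡sumPositions k (suc n) ⟩
    sumPositions k (suc n) (λ _ → 1)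
  ≡⟨ sumPositions-suc-≤ (<⇒≤ n<k) _ ⟩
    sumPositions k n (λ _ → 1) + 2
  ≡⟨ cong (_+ 2) (trans (sym (total≡sumPositions k n)) (total-≤ (<⇒≤ n<k))) ⟩
    2 * n + 1 + 2
  ≡⟨ arithmetic n ⟩
    2 * suc n + 1
  ∎
  where
  arithmetic : ∀ n → 2 * n + 1 + 2 ≡ 2 * suc n + 1
  arithmetic = solve-∀

total-suc-+ : ∀ k m → total k (suc (k + m)) ≡ total k (k + m) + 2 * total k m
total-suc-+ k m = begin
    total k (suc (k + m))
  ≡⟨ total≡sumPositions k (suc (k + m)) ⟩
    sumPositions k (suc (k + m)) (λ _ → 1)
  ≡⟨ sumPositions-suc-+ k m _ ⟩
    sumPositions k (k + m) (λ _ → 1) + (sumPositions k m (λ _ → 1) + sumPositions k m (λ _ → 1))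
  ≡⟨ cong₂ (λ a b → a + (b + b))
            (sym (total≡sumPositions k (k + m))) (sym (total≡sumPositions k m)) ⟩
    total k (k + m) + (total k m + total k m)
  ≡⟨ cong (λ b → total k (k + m) + (total k m + b)) (sym (+-identityʳ (total k m))) ⟩
    total k (k + m) + 2 * total k m
  ∎

elimAbove : ∀ k (P : ℕ → ℕ → Set) → (∀ m → P (suc (k + m)) m) →
  ∀ n → k < n → P n (n ∸ suc k)
elimAbove k P step n k<n = subst (λ n′ → P n′ (n ∸ suc k)) (m+[n∸m]≡n k<n) (step (n ∸ suc k))

mainTheorem1 : (k : ℕ) → 1 ≤ k →
    ((n : ℕ) → n ≤ k → (j l : ℕ) → profile k n j l ≡ onePlusNxNy n j l)
    × ((n : ℕ) → k < n → (j l : ℕ) →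
         profile k n j l ≡ (profile k (n ∸ 1) ⊕ xyTimes (profile k (n ∸ suc k))) j l)
    × ((n : ℕ) → n ≤ k → total k n ≡ 2 * n + 1)
    × ((n : ℕ) → k < n → total k n ≡ total k (n ∸ 1) + 2 * total k (n ∸ suc k))
mainTheorem1 k _ =
    (λ n → profile-≤)
  , elimAbove k (λ n m → profile k n ≐ profile k (n ∸ 1) ⊕ xyTimes (profile k m))
                (profile-suc-+ k)
  , (λ n → total-≤)
  , elimAbove k (λ n m → total k n ≡ total k (n ∸ 1) + 2 * total k m) (total-suc-+ k)
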